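{- Let $k,n$ be positive integers with $k^2+1\le n\le k^2+k$, and let $t,r_1,\dots,r_t,s_1,\dots,s_t$ be positive integers such that $r_1s_1+\dots+r_ts_t=n$ and $r_1>r_2>\dots>r_t$ (the latter condition being vacuous for $t=1$). Then $r_1+s_1+s_2+\dots+s_t\ge 2k+1$. -}

module Defs where

open import Data.Nat using (ℕ; zero; suc; _+_; _*_)
open import Data.Fin using (Fin)

finSum : (t : ℕ) → (Fin t → ℕ) → ℕ
finSum zero f = 0
finSum (suc t) f = f Fin.zero + finSum t (λ i → f (Fin.suc i))

-- Since r₁ is the largest part, n = Σ rᵢ sᵢ ≤ r₁ · S with S = Σ sᵢ, so k² < r₁ S.
-- By AM-GM, (r₁ + S)² ≥ 4 r₁ S > 4k², hence r₁ + S > 2k.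
module Submission where

open import Defs
open import Relation.Binary.PropositionalEquality using (_≡_; refl; sym; cong; cong₂; subst; subst₂)
open import Data.Nat using (ℕ; suc; _+_; _*_; _≤_; _<_; z≤n; s≤s)
open import Data.Nat.Properties
open import Data.Nat.Tactic.RingSolver using (solve-∀)
open import Data.Fin using (Fin; zero)
import Data.Fin as F
open import Algebra.Definitions.RawMagma using (_,_)
open import Data.Sum using (inj₁; inj₂)

finSum-*≤*finSum : ∀ t {R} (r s : Fin t → ℕ) → (∀ i → r i ≤ R)
  → finSum t (λ i → r i * s i) ≤ R * finSum t s
finSum-*≤*finSum ℕ.zero    r s r≤R = z≤n
finSum-*≤*finSum (suc t) {R} r s r≤R = begin
  r zero * s zero + finSum t (λ i → r (F.suc i) * s (F.suc i))
    ≤⟨ +-mono-≤ (*-monoˡ-≤ (s zero) (r≤R zero))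
                (finSum-*≤*finSum t (λ i → r (F.suc i)) (λ i → s (F.suc i)) (λ i → r≤R (F.suc i))) ⟩
  R * s zero + R * finSum t (λ i → s (F.suc i))
    ≡⟨ sym (*-distribˡ-+ R (s zero) _) ⟩
  R * finSum (suc t) s ∎
  where open ≤-Reasoning

[m+[m+d]]²≡4*[m*[m+d]]+d² : ∀ m d → (m + (m + d)) * (m + (m + d)) ≡ 4 * (m * (m + d)) + d * d
[m+[m+d]]²≡4*[m*[m+d]]+d² = solve-∀

m≤n⇒4*[m*n]≤[m+n]² : ∀ {m n} → m ≤ n → 4 * (m * n) ≤ (m + n) * (m + n)
m≤n⇒4*[m*n]≤[m+n]² {m} m≤n with ≤⇒≤″ m≤n
... | d , refl = begin
  4 * (m * (m + d))              ≤⟨ m≤m+n _ (d * d) ⟩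
  4 * (m * (m + d)) + d * d      ≡⟨ sym ([m+[m+d]]²≡4*[m*[m+d]]+d² m d) ⟩
  (m + (m + d)) * (m + (m + d))  ∎
  where open ≤-Reasoning

4*[m*n]≤[m+n]² : ∀ m n → 4 * (m * n) ≤ (m + n) * (m + n)
4*[m*n]≤[m+n]² m n with ≤-total m n
... | inj₁ m≤n = m≤n⇒4*[m*n]≤[m+n]² m≤n
... | inj₂ n≤m = subst₂ _≤_ (cong (4 *_) (*-comm n m)) (cong₂ _*_ (+-comm n m) (+-comm n m))
                        (m≤n⇒4*[m*n]≤[m+n]² n≤m)

m+n≤2k⇒m*n≤k² : ∀ k m n → m + n ≤ 2 * k → m * n ≤ k * k
m+n≤2k⇒m*n≤k² k m n m+n≤2k = *-cancelˡ-≤ 4 (begin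
  4 * (m * n)          ≤⟨ 4*[m*n]≤[m+n]² m n ⟩
  (m + n) * (m + n)    ≤⟨ *-mono-≤ m+n≤2k m+n≤2k ⟩
  (2 * k) * (2 * k)    ≡⟨ [2k]²≡4k² k ⟩
  4 * (k * k)          ∎)
  where
  open ≤-Reasoning
  [2k]²≡4k² : ∀ k → (2 * k) * (2 * k) ≡ 4 * (k * k)
  [2k]²≡4k² = solve-∀

k²<m*n⇒2k+1≤m+n : ∀ k m n → k * k < m * n → 2 * k + 1 ≤ m + n
k²<m*n⇒2k+1≤m+n k m n k²<mn = subst (_≤ m + n) (+-comm 1 (2 * k))
  (≰⇒> λ m+n≤2k → <⇒≱ k²<mn (m+n≤2k⇒m*n≤k² k m n m+n≤2k))

proposition7p7 : (k n t : ℕ) → 1 ≤ k → 1 ≤ n → (k * k + 1 ≤ n) → (n ≤ k * k + k)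
    → (1≤t : 1 ≤ t) → (r s : Fin t → ℕ)
    → (∀ i → 1 ≤ r i) → (∀ i → 1 ≤ s i)
    → finSum t (λ i → r i * s i) ≡ n
    → (∀ (i j : Fin t) → i F.< j → r j < r i)
    → 2 * k + 1 ≤ r (F.fromℕ< 1≤t) + finSum t s
proposition7p7 k n (suc t) _ _ k²+1≤n _ (s≤s z≤n) r s _ _ Σrs≡n r-decreasing =
  k²<m*n⇒2k+1≤m+n k (r zero) (finSum (suc t) s) (begin-strict
    k * k                                 <⟨ subst (_≤ n) (+-comm (k * k) 1) k²+1≤n ⟩
    n                                     ≡⟨ sym Σrs≡n ⟩
    finSum (suc t) (λ i → r i * s i)      ≤⟨ finSum-*≤*finSum (suc t) r s r≤r₀ ⟩
    r zero * finSum (suc t) s             ∎)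
  where
  open ≤-Reasoning
  r≤r₀ : ∀ i → r i ≤ r zero
  r≤r₀ zero      = ≤-refl
  r≤r₀ (F.suc i) = <⇒≤ (r-decreasing zero (F.suc i) (s≤s z≤n))
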